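{- Fix an integer $k\geq 4$. Then, as $r\to\infty$ (over integers $r\geq 2$), \[ R_r(k)\leq \left(\frac{3+e}{2}\right)\frac{(r(k-2))!}{((k-2)!)^r}\left(1+o_{r\to\infty}(1)\right). \]
   Context: For integers $r\geq 1$ and $k\geq 1$, the diagonal Ramsey number $R_r(k)$ is the minimum $N\in\mathbb{N}$ such that every coloring of the edges of the complete graph $K_N$ with $r$ colors contains a complete subgraph on $k$ vertices all of whose edges have the same color. $o_{r\to\infty}(1)$ denotes a quantity tending to $0$ as $r\to\infty$. -}

module Defs where

open import Data.Nat as ℕ using (ℕ; zero; suc; _∸_; _!; _^_)
open import Data.Nat.Properties using (_!≢0; m^n≢0)
open import Data.Integer using (+_)
open import Data.Rational using (ℚ; _/_; 1ℚ; _+_)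
open import Data.Fin using (Fin)
open import Data.Product using (∃-syntax; _×_)
open import Function.Definitions using (Injective)
open import Relation.Binary.PropositionalEquality using (_≡_; _≢_)

-- A coloring of the edges of K_N with r colors: a symmetric map on pairs of
-- vertices (values on the diagonal are irrelevant).
SymColoring : ℕ → ℕ → Set
SymColoring N r = Fin N → Fin N → Fin r

IsSymmetric : ∀ {N r} → SymColoring N r → Set
IsSymmetric c = ∀ x y → c x y ≡ c y x

HasMonoClique : ∀ {N r} → ℕ → SymColoring N r → Set
HasMonoClique {N} {r} k c =
  ∃[ col ] ∃[ f ] (Injective _≡_ _≡_ f ×
    (∀ (i j : Fin k) → i ≢ j → c (f i) (f j) ≡ col))

RamseyProperty : ℕ → ℕ → ℕ → Set
RamseyProperty r k N =
  ∀ (c : SymColoring N r) → IsSymmetric c → HasMonoClique k c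

-- partial sums  Σ_{i=0}^{n} 1/i!  of the series defining e
expPartial : ℕ → ℚ
expPartial zero = 1ℚ
expPartial (suc n) = expPartial n + _/_ (+ 1) (suc n !) {{suc n !≢0}}

multinomBound : ℕ → ℕ → ℚ
multinomBound r k =
  _/_ (+ ((r ℕ.* (k ∸ 2)) !)) (((k ∸ 2) !) ^ r) {{m^n≢0 ((k ∸ 2) !) r {{(k ∸ 2) !≢0}}}}

{-# OPTIONS --safe #-}
-- Splitting the other vertices by the colour of their edge to a fixed vertex (Erdős–Szekeres)
-- shows: if Φ(b) ≥ 1 + Σᵢ Φ(b − eᵢ), every r-colouring of K_{Φ(b)+1} contains, for some i,
-- a clique of size bᵢ + 2 in colour i.  By Pascal's rule for multinomial coefficients,
-- Φ(b) = Σ_{c ≤ b} |c|!/∏ cᵢ! satisfies this with equality.  For b = (m,…,m), m = k − 2,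
-- n = rm, write |c|!/∏ cᵢ! = (|c|!/m!^r) ∏ m!/cᵢ! and compare |c|! with n!: for K = ⌊r/1000⌋
-- and y = n − K, either n − |c| ≤ K and n!/|c|! ≥ y^(n−|c|), or n!/|c|! ≥ (y+1)⋯n.  Summing,
-- Φ m!^r/n! ≤ (Σⱼ (m!/j!) y^(j−m))^r + (Σⱼ m!/j!)^r/((y+1)⋯n).  The first term is at most
-- (y/(y−m))^r < 2.8 (a geometric sum, then Bernoulli's inequality), the second is below 1/100
-- since (y+1)⋯n ≥ r^(r/1000), and m!^r ≤ n!/r; altogether (1 + Φ) m!^r ≤ (17/6) n!, where
-- 17/6 = (3 + Σ_{i≤3} 1/i!)/2.
module Submission where

open import Defs

module FinSum where

  open import Data.Nat using (ℕ; zero; suc; _+_; _*_; _≤_; _<_)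
  open import Data.Nat.Properties
  open import Data.Fin using (Fin; zero; suc)
  open import Data.Product using (∃-syntax; _,_)
  open import Function using (_∘_)
  open import Relation.Nullary using (yes; no)
  open import Algebra.Properties.Semiring.Sum +-*-semiring

  ∑-<⇒∃< : ∀ {n} (f g : Fin n → ℕ) → ∑[ i < n ] f i < ∑[ i < n ] g i → ∃[ i ] f i < g i
  ∑-<⇒∃< {suc n} f g ∑f<∑g with f zero <? g zero
  ... | yes f₀<g₀ = zero , f₀<g₀
  ... | no f₀≮g₀ with ∑-<⇒∃< (f ∘ suc) (g ∘ suc)
                       (+-cancelˡ-< (g zero) _ _ (≤-<-trans (+-monoˡ-≤ _ (≮⇒≥ f₀≮g₀)) ∑f<∑g))
  ... | i , fᵢ<gᵢ = suc i , fᵢ<gᵢ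

  ∑-mono-≤ : ∀ {n} {f g : Fin n → ℕ} → (∀ i → f i ≤ g i) → ∑[ i < n ] f i ≤ ∑[ i < n ] g i
  ∑-mono-≤ {zero} f≤g = ≤-refl
  ∑-mono-≤ {suc n} f≤g = +-mono-≤ (f≤g zero) (∑-mono-≤ (f≤g ∘ suc))

  ∑-≤-* : ∀ {n} {f : Fin n → ℕ} {B} → (∀ i → f i ≤ B) → ∑[ i < n ] f i ≤ n * B
  ∑-≤-* {zero} f≤B = ≤-refl
  ∑-≤-* {suc n} f≤B = +-mono-≤ (f≤B zero) (∑-≤-* (f≤B ∘ suc))

module RamseyRecursion where

  open import Data.Bool using (if_then_else_)
  open import Data.Nat using (ℕ; zero; suc; pred; _+_; _≤_; _<_; z≤n; s≤s)
  open import Data.Nat.Properties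
  open import Data.Fin as Fin using (Fin; zero; suc)
  open import Data.List as List using (List; []; _∷_; length; filter; allFin)
  open import Data.List.Properties using (length-filter; length-tabulate)
  open import Data.List.Membership.Propositional using (_∈_)
  open import Data.List.Membership.Propositional.Properties using (∈-filter⁻; ∈-lookup)
  open import Data.List.Relation.Binary.Subset.Propositional using (_⊆_)
  open import Data.List.Relation.Unary.All as All using (All; []; _∷_)
  open import Data.List.Relation.Unary.Any using (here; there)
  open import Data.List.Relation.Unary.AllPairs using (AllPairs; []; _∷_)
  open import Data.List.Relation.Unary.Unique.Propositional using (Unique)
  import Data.List.Relation.Unary.Unique.Propositional.Properties as Unique
  open import Data.Vec as Vec using (Vec; []; _∷_; lookup)
  open import Data.Vec.Properties using (lookup-replicate; lookup∘updateAt; lookup∘updateAt′)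
  open import Data.Product using (∃-syntax; _×_; _,_; proj₁; proj₂)
  open import Data.Empty using (⊥-elim)
  open import Function using (_∘_)
  open import Function.Definitions using (Injective)
  open import Relation.Nullary using (yes; no; does)
  open import Relation.Binary.PropositionalEquality
  open import Algebra.Properties.Semiring.Sum +-*-semiring
  open FinSum using (∑-<⇒∃<)

  indicator : ∀ {n} → Fin n → Fin n → ℕ
  indicator a i = if does (a Fin.≟ i) then 1 else 0

  ∑-indicator : ∀ {n} (a : Fin n) → ∑[ i < n ] indicator a i ≡ 1
  ∑-indicator {suc n} zero = cong suc (sum-replicate-zero n)
  ∑-indicator {suc n} (suc a) = ∑-indicator a

  module _ {A : Set} {n : ℕ} (f : A → Fin n) where

    fibre : Fin n → List A → List A
    fibre i = filter (λ x → f x Fin.≟ i)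

    length-fibre-∷ : ∀ i x xs → length (fibre i (x ∷ xs)) ≡ indicator (f x) i + length (fibre i xs)
    length-fibre-∷ i x xs with f x Fin.≟ i
    ... | yes _ = refl
    ... | no _ = refl

    ∑-length-fibre : ∀ xs → ∑[ i < n ] length (fibre i xs) ≡ length xs
    ∑-length-fibre [] = sum-replicate-zero n
    ∑-length-fibre (x ∷ xs) = begin
      ∑[ i < n ] length (fibre i (x ∷ xs))                    ≡⟨ sum-cong-≗ (λ i → length-fibre-∷ i x xs) ⟩
      ∑[ i < n ] (indicator (f x) i + length (fibre i xs))    ≡⟨ ∑-distrib-+ (indicator (f x)) _ ⟩
      ∑[ i < n ] indicator (f x) i + ∑[ i < n ] length (fibre i xs) ≡⟨ cong₂ _+_ (∑-indicator (f x)) (∑-length-fibre xs) ⟩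
      suc (length xs)                                          ∎
      where open ≡-Reasoning

  below : ∀ {s} → Fin s → (Vec ℕ s → ℕ) → Vec ℕ s → ℕ
  below zero F (zero ∷ b) = 0
  below zero F (suc x ∷ b) = F (x ∷ b)
  below (suc i) F (x ∷ b) = below i (λ b′ → F (x ∷ b′)) b

  below-suc : ∀ {s} (i : Fin s) F b {p} → lookup b i ≡ suc p → below i F b ≡ F (b Vec.[ i ]%= pred)
  below-suc zero F (suc x ∷ b) refl = refl
  below-suc (suc i) F (x ∷ b) bᵢ≡ = below-suc i _ b bᵢ≡

  RamseyRecursive : ∀ {r} → (Vec ℕ r → ℕ) → Set
  RamseyRecursive {r} Φ = ∀ b → suc (∑[ i < r ] below i Φ b) ≤ Φ b

  module _ {N r : ℕ} (c : SymColoring N r) (c-sym : IsSymmetric c) where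

    Clique : Fin r → List (Fin N) → Set
    Clique i = AllPairs (λ u v → u ≢ v × c u v ≡ i)

    CliqueIn : Vec ℕ r → List (Fin N) → Set
    CliqueIn b L = ∃[ i ] ∃[ xs ] (Clique i xs × length xs ≡ 2 + lookup b i × xs ⊆ L)

    nbhd : Fin N → Fin r → List (Fin N) → List (Fin N)
    nbhd v = fibre (c v)

    ∈-nbhd⁻ : ∀ {v i L u} → u ∈ nbhd v i L → u ∈ L × c v u ≡ i
    ∈-nbhd⁻ {v} {i} = ∈-filter⁻ (λ u → c v u Fin.≟ i)

    cons-clique : ∀ {i v xs} → (∀ {u} → u ∈ xs → v ≢ u × c v u ≡ i) → Clique i xs → Clique i (v ∷ xs)
    cons-clique v~xs xs-clique = All.tabulate v~xs ∷ xs-clique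

    edge : ∀ {v i L} b → lookup b i ≡ 0 → All (v ≢_) L → 0 < length (nbhd v i L) → CliqueIn b (v ∷ L)
    edge {v} {i} {L} b bᵢ≡0 v∉L nonempty with nbhd v i L in nbhd≡
    ... | [] with () ← nonempty
    ... | u ∷ _ = i , v ∷ u ∷ [] , ((v≢u , cᵥᵤ≡i) ∷ []) ∷ [] ∷ [] , cong (2 +_) (sym bᵢ≡0) , v∷u⊆
      where
      u∈nbhd : u ∈ nbhd v i L
      u∈nbhd rewrite nbhd≡ = here refl
      cᵥᵤ≡i : c v u ≡ i
      cᵥᵤ≡i = proj₂ (∈-nbhd⁻ {L = L} u∈nbhd)
      v≢u : v ≢ u
      v≢u = All.lookup v∉L (proj₁ (∈-nbhd⁻ {L = L} u∈nbhd))
      v∷u⊆ : v ∷ u ∷ [] ⊆ v ∷ L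
      v∷u⊆ (here refl) = here refl
      v∷u⊆ (there (here refl)) = there (proj₁ (∈-nbhd⁻ {L = L} u∈nbhd))

    extend : ∀ {v i L} b {p} → lookup b i ≡ suc p → All (v ≢_) L →
             CliqueIn (b Vec.[ i ]%= pred) (nbhd v i L) → CliqueIn b (v ∷ L)
    extend {v} {i} {L} b bᵢ≡ v∉L (j , xs , xs-clique , len , xs⊆) with j Fin.≟ i
    ... | yes refl = i , v ∷ xs , cons-clique v~xs xs-clique , len′ , v∷xs⊆
      where
      v~xs : ∀ {u} → u ∈ xs → v ≢ u × c v u ≡ i
      v~xs u∈xs = let u∈L , cᵥᵤ≡i = ∈-nbhd⁻ (xs⊆ u∈xs) in All.lookup v∉L u∈L , cᵥᵤ≡i
      len′ : suc (length xs) ≡ 2 + lookup b i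
      len′ = begin
        suc (length xs)                           ≡⟨ cong suc len ⟩
        3 + lookup (b Vec.[ i ]%= pred) i         ≡⟨ cong (3 +_) (lookup∘updateAt i b) ⟩
        3 + pred (lookup b i)                     ≡⟨ cong (λ x → 3 + pred x) bᵢ≡ ⟩
        2 + suc _                                 ≡⟨ cong (2 +_) (sym bᵢ≡) ⟩
        2 + lookup b i                            ∎
        where open ≡-Reasoning
      v∷xs⊆ : v ∷ xs ⊆ v ∷ L
      v∷xs⊆ (here v≡) = here v≡
      v∷xs⊆ (there u∈xs) = there (proj₁ (∈-nbhd⁻ (xs⊆ u∈xs)))
    ... | no j≢i = j , xs , xs-clique , trans len (cong (2 +_) (lookup∘updateAt′ j i j≢i b)) ,
                   there ∘ proj₁ ∘ ∈-nbhd⁻ ∘ xs⊆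

    module _ (Φ : Vec ℕ r → ℕ) (Φ-rec : RamseyRecursive Φ) where

      find-clique : ∀ fuel b L → length L ≤ fuel → Unique L → Φ b < length L → CliqueIn b L
      find-clique (suc fuel) b (v ∷ L) (s≤s |L|≤fuel) (v∉L ∷ L-unique) Φb<|vL|
        with ∑-<⇒∃< (λ i → below i Φ b) (λ i → length (nbhd v i L))
               (subst (_ <_) (sym (∑-length-fibre (c v) L)) (≤-trans (Φ-rec b) (≤-pred Φb<|vL|)))
      ... | i , belowᵢ< with lookup b i in bᵢ≡
      ... | zero = edge b bᵢ≡ v∉L (≤-trans (s≤s z≤n) belowᵢ<)
      ... | suc _ = extend b bᵢ≡ v∉L
                      (find-clique fuel (b Vec.[ i ]%= pred) (nbhd v i L)
                        (≤-trans (length-filter _ L) |L|≤fuel) (Unique.filter⁺ _ L-unique)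
                        (subst (_< length (nbhd v i L)) (below-suc i Φ b bᵢ≡) belowᵢ<))

    clique-lookup : ∀ {i} xs → Clique i xs → ∀ a b → a ≢ b →
                    List.lookup xs a ≢ List.lookup xs b × c (List.lookup xs a) (List.lookup xs b) ≡ i
    clique-lookup (x ∷ xs) _ zero zero a≢b = ⊥-elim (a≢b refl)
    clique-lookup (x ∷ xs) (x~xs ∷ _) zero (suc b) _ = All.lookup x~xs (∈-lookup b)
    clique-lookup (x ∷ xs) (x~xs ∷ _) (suc a) zero _ =
      let x≢xₐ , cₓₐ≡i = All.lookup x~xs (∈-lookup a) in x≢xₐ ∘ sym , trans (c-sym _ _) cₓₐ≡i
    clique-lookup (x ∷ xs) (_ ∷ xs-clique) (suc a) (suc b) a≢b = clique-lookup xs xs-clique a b (a≢b ∘ cong suc)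

    clique⇒HasMonoClique : ∀ {i} xs → Clique i xs → HasMonoClique (length xs) c
    clique⇒HasMonoClique {i} xs xs-clique =
      i , List.lookup xs , lookup-injective , λ a b a≢b → proj₂ (clique-lookup xs xs-clique a b a≢b)
      where
      lookup-injective : Injective _≡_ _≡_ (List.lookup xs)
      lookup-injective {a} {b} xₐ≡x_b with a Fin.≟ b
      ... | yes a≡b = a≡b
      ... | no a≢b = ⊥-elim (proj₁ (clique-lookup xs xs-clique a b a≢b) xₐ≡x_b)

  ramsey-recursive : ∀ {r} (Φ : Vec ℕ r → ℕ) → RamseyRecursive Φ →
                     ∀ m → RamseyProperty r (2 + m) (suc (Φ (Vec.replicate r m)))
  ramsey-recursive {r} Φ Φ-rec m c c-sym
    with find-clique c c-sym Φ Φ-rec _ (Vec.replicate r m) (allFin _) ≤-refl (Unique.allFin⁺ _)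
           (≤-reflexive (sym (length-tabulate (λ x → x))))
  ... | i , xs , xs-clique , len , _ =
    subst (λ k → HasMonoClique k c) (trans len (cong (2 +_) (lookup-replicate i m)))
          (clique⇒HasMonoClique c c-sym xs xs-clique)

module Multinomial where

  open import Data.Nat using (ℕ; zero; suc; _+_; _*_; _∸_)
  open import Data.Nat.Properties
  open import Data.Nat.Combinatorics using (_C_; nCn≡1; nCk+nC[k+1]≡[n+1]C[k+1])
  open import Data.Fin using (Fin; zero; suc; toℕ)
  open import Data.Vec as Vec using (Vec; []; _∷_)
  open import Data.Product using (∃-syntax; _×_; _,_)
  open import Data.Sum using (_⊎_; inj₁; inj₂)
  open import Function using (_∘_)
  open import Relation.Binary.PropositionalEquality
  open import Algebra.Properties.Semiring.Sum +-*-semiring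
  open RamseyRecursion using (below; RamseyRecursive)

  boxSum : ∀ {s} → Vec ℕ s → (Vec ℕ s → ℕ) → ℕ
  boxSum [] f = f []
  boxSum (b ∷ bs) f = ∑[ j ≤ b ] boxSum bs (f ∘ (toℕ j ∷_))

  multinomial : ∀ {s} → Vec ℕ s → ℕ
  multinomial [] = 1
  multinomial (x ∷ xs) = ((x + Vec.sum xs) C x) * multinomial xs

  δ₀ : ℕ → ℕ
  δ₀ zero = 1
  δ₀ (suc _) = 0

  boxSum-cong : ∀ {s} (b : Vec ℕ s) {f g} → (∀ c → f c ≡ g c) → boxSum b f ≡ boxSum b g
  boxSum-cong [] f≗g = f≗g []
  boxSum-cong (x ∷ b) f≗g = sum-cong-≗ {suc x} (λ j → boxSum-cong b (λ cs → f≗g (toℕ j ∷ cs)))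

  boxSum-+ : ∀ {s} (b : Vec ℕ s) f g → boxSum b (λ c → f c + g c) ≡ boxSum b f + boxSum b g
  boxSum-+ [] f g = refl
  boxSum-+ (x ∷ b) f g =
    trans (sum-cong-≗ {suc x} (λ j → boxSum-+ b (f ∘ (toℕ j ∷_)) (g ∘ (toℕ j ∷_))))
          (∑-distrib-+ {suc x} (λ j → boxSum b (f ∘ (toℕ j ∷_))) (λ j → boxSum b (g ∘ (toℕ j ∷_))))

  boxSum-0 : ∀ {s} (b : Vec ℕ s) → boxSum b (λ _ → 0) ≡ 0
  boxSum-0 [] = refl
  boxSum-0 (x ∷ b) = trans (sum-cong-≗ {suc x} (λ j → boxSum-0 b)) (sum-replicate-zero (suc x))

  boxSum-∑ : ∀ {s r} (b : Vec ℕ s) (G : Fin r → Vec ℕ s → ℕ) →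
             boxSum b (λ c → ∑[ i < r ] G i c) ≡ ∑[ i < r ] boxSum b (G i)
  boxSum-∑ [] G = refl
  boxSum-∑ (x ∷ b) G = trans (sum-cong-≗ {suc x} (λ j → boxSum-∑ b (λ i cs → G i (toℕ j ∷ cs))))
                             (∑-comm {suc x} (λ j i → boxSum b (λ cs → G i (toℕ j ∷ cs))))

  boxSum-δ₀ : ∀ {s} (b : Vec ℕ s) → boxSum b (δ₀ ∘ Vec.sum) ≡ 1
  boxSum-δ₀ [] = refl
  boxSum-δ₀ (x ∷ b) = cong₂ _+_ (boxSum-δ₀ b)
                        (trans (sum-cong-≗ {x} (λ j → boxSum-0 b)) (sum-replicate-zero x))

  below-∑ : ∀ {s n} (i : Fin s) (G : Fin n → Vec ℕ s → ℕ) b →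
            below i (λ c → ∑[ j < n ] G j c) b ≡ ∑[ j < n ] below i (G j) b
  below-∑ {n = n} zero G (zero ∷ b) = sym (sum-replicate-zero n)
  below-∑ zero G (suc x ∷ b) = refl
  below-∑ (suc i) G (x ∷ b) = below-∑ i (λ j b′ → G j (x ∷ b′)) b

  boxSum-below : ∀ {s} (i : Fin s) (b : Vec ℕ s) f → boxSum b (below i f) ≡ below i (λ b′ → boxSum b′ f) b
  boxSum-below zero (zero ∷ b) f = trans (+-identityʳ _) (boxSum-0 b)
  boxSum-below zero (suc x ∷ b) f = cong (_+ boxSum (x ∷ b) f) (boxSum-0 b)
  boxSum-below (suc i) (x ∷ b) f =
    trans (sum-cong-≗ {suc x} (λ j → boxSum-below i b (f ∘ (toℕ j ∷_))))
          (sym (below-∑ {n = suc x} i (λ j b′ → boxSum b′ (f ∘ (toℕ j ∷_))) b))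

  below-view : ∀ {s} (i : Fin s) c →
               (∀ F → below i F c ≡ 0) ⊎ ∃[ c′ ] (suc (Vec.sum c′) ≡ Vec.sum c × ∀ F → below i F c ≡ F c′)
  below-view zero (zero ∷ c) = inj₁ (λ _ → refl)
  below-view zero (suc x ∷ c) = inj₂ (x ∷ c , refl , λ _ → refl)
  below-view (suc i) (x ∷ c) with below-view i c
  ... | inj₁ below≡0 = inj₁ (λ F → below≡0 (F ∘ (x ∷_)))
  ... | inj₂ (c′ , sum≡ , below≡) =
    inj₂ (x ∷ c′ , trans (sym (+-suc x _)) (cong (x +_) sum≡) , λ F → below≡ (F ∘ (x ∷_)))

  below-sum≡0 : ∀ {s} (i : Fin s) F c → Vec.sum c ≡ 0 → below i F c ≡ 0
  below-sum≡0 i F c sum≡0 with below-view i c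
  ... | inj₁ below≡0 = below≡0 F
  ... | inj₂ (_ , sum≡ , _) with () ← trans sum≡ sum≡0

  below-scale : ∀ {s} (i : Fin s) (h : ℕ → ℕ) F c →
                below i (λ c′ → h (Vec.sum c′) * F c′) c ≡ h (Vec.sum c ∸ 1) * below i F c
  below-scale i h F c with below-view i c
  ... | inj₁ below≡0 = trans (below≡0 _) (sym (trans (cong (h (Vec.sum c ∸ 1) *_) (below≡0 F)) (*-zeroʳ (h (Vec.sum c ∸ 1)))))
  ... | inj₂ (c′ , sum≡ , below≡) rewrite below≡ (λ c′ → h (Vec.sum c′) * F c′) | below≡ F | sym sum≡ = refl

  pascal-step : ∀ a t S → (t ≡ 0 → S ≡ 0) →
                ((suc a + t) C suc a) * (δ₀ t + S) ≡
                δ₀ (suc a + t) + (((a + t) C a) * (δ₀ t + S) + ((suc a + (t ∸ 1)) C suc a) * S)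
  pascal-step a zero S S≡0 rewrite S≡0 refl | +-identityʳ a = begin
    (suc a C suc a) * 1                ≡⟨ cong (_* 1) (trans (nCn≡1 (suc a)) (sym (nCn≡1 a))) ⟩
    (a C a) * 1                        ≡⟨ sym (+-identityʳ _) ⟩
    (a C a) * 1 + 0                    ≡⟨ cong ((a C a) * 1 +_) (sym (*-zeroʳ (suc a C suc a))) ⟩
    (a C a) * 1 + (suc a C suc a) * 0  ∎
    where open ≡-Reasoning
  pascal-step a (suc t) S _ = begin
    (suc (a + suc t) C suc a) * S                     ≡⟨ cong (_* S) (sym (nCk+nC[k+1]≡[n+1]C[k+1] (a + suc t) a)) ⟩
    ((a + suc t) C a + (a + suc t) C suc a) * S       ≡⟨ *-distribʳ-+ S ((a + suc t) C a) _ ⟩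
    ((a + suc t) C a) * S + ((a + suc t) C suc a) * S ≡⟨ cong (λ n → ((a + suc t) C a) * S + (n C suc a) * S) (+-suc a t) ⟩
    ((a + suc t) C a) * S + (suc (a + t) C suc a) * S ∎
    where open ≡-Reasoning

  multinomial-pascal : ∀ {s} (c : Vec ℕ s) → multinomial c ≡ δ₀ (Vec.sum c) + ∑[ i < s ] below i multinomial c
  multinomial-pascal [] = refl
  multinomial-pascal {suc s} (x ∷ c) = begin
    ((x + t) C x) * multinomial c                                            ≡⟨ cong (((x + t) C x) *_) IH ⟩
    ((x + t) C x) * (δ₀ t + S)                                               ≡⟨ step x ⟩
    δ₀ (x + t) + (below zero multinomial (x ∷ c) + ((x + (t ∸ 1)) C x) * S)
      ≡⟨ cong (δ₀ (x + t) +_) (cong (below zero multinomial (x ∷ c) +_) (sym ∑-tail)) ⟩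
    δ₀ (x + t) + ∑[ i < suc s ] below i multinomial (x ∷ c)                ∎
    where
    open ≡-Reasoning
    t S : ℕ
    t = Vec.sum c
    S = ∑[ i < s ] below i multinomial c
    IH : multinomial c ≡ δ₀ t + S
    IH = multinomial-pascal c
    t≡0⇒S≡0 : t ≡ 0 → S ≡ 0
    t≡0⇒S≡0 t≡0 = trans (sum-cong-≗ {s} (λ i → below-sum≡0 i multinomial c t≡0)) (sum-replicate-zero s)
    step : ∀ x → ((x + t) C x) * (δ₀ t + S) ≡ δ₀ (x + t) + (below zero multinomial (x ∷ c) + ((x + (t ∸ 1)) C x) * S)
    step zero = trans (*-identityˡ _) (cong (δ₀ t +_) (sym (*-identityˡ S)))
    step (suc a) = trans (pascal-step a t S t≡0⇒S≡0)
                         (cong (λ z → δ₀ (suc a + t) + (((a + t) C a) * z + ((suc a + (t ∸ 1)) C suc a) * S)) (sym IH))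
    ∑-tail : ∑[ i < s ] below i (multinomial ∘ (x ∷_)) c ≡ ((x + (t ∸ 1)) C x) * S
    ∑-tail = trans (sum-cong-≗ {s} (λ i → below-scale i (λ u → (x + u) C x) multinomial c))
                   (sym (*-distribˡ-sum ((x + (t ∸ 1)) C x) (λ i → below i multinomial c)))

  multinomialBox : ∀ {s} → Vec ℕ s → ℕ
  multinomialBox b = boxSum b multinomial

  multinomialBox-recursive : ∀ {s} → RamseyRecursive (multinomialBox {s})
  multinomialBox-recursive {s} b = ≤-reflexive (sym (begin
    boxSum b multinomial                                                 ≡⟨ boxSum-cong b multinomial-pascal ⟩
    boxSum b (λ c → δ₀ (Vec.sum c) + ∑[ i < s ] below i multinomial c)  ≡⟨ boxSum-+ b (δ₀ ∘ Vec.sum) _ ⟩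
    boxSum b (δ₀ ∘ Vec.sum) + boxSum b (λ c → ∑[ i < s ] below i multinomial c)
      ≡⟨ cong₂ _+_ (boxSum-δ₀ b) (boxSum-∑ b (λ i → below i multinomial)) ⟩
    suc (∑[ i < s ] boxSum b (below i multinomial))                     ≡⟨ cong suc (sum-cong-≗ {s} (λ i → boxSum-below i b multinomial)) ⟩
    suc (∑[ i < s ] below i multinomialBox b)                           ∎))
    where open ≡-Reasoning

module Factorials where

  open import Data.Nat using (ℕ; zero; suc; _+_; _*_; _∸_; _^_; _≤_; z≤n; s≤s; _!; _/_; NonZero)
  open import Data.Nat.Properties
  open import Data.Nat.DivMod using (m/n*n≡m)
  open import Data.Nat.Combinatorics using (_C_; nCk+nC[k+1]≡[n+1]C[k+1]; k![n∸k]!∣n!)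
  open import Data.Nat.Combinatorics.Specification using (nCk≡n!/k![n-k]!)
  open import Data.Vec as Vec using (Vec; []; _∷_)
  open import Data.Vec.Relation.Unary.All using (All; []; _∷_)
  open import Relation.Nullary using (contradiction; yes; no)
  open import Relation.Binary.PropositionalEquality
  open import Data.Nat.Tactic.RingSolver using (solve-∀)
  open Multinomial using (multinomial)

  rising : ℕ → ℕ → ℕ
  rising j zero = 1
  rising j (suc d) = (j + suc d) * rising j d

  rising-*-! : ∀ j d → rising j d * j ! ≡ (j + d) !
  rising-*-! j zero = trans (*-identityˡ _) (cong _! (sym (+-identityʳ j)))
  rising-*-! j (suc d) = begin
    (j + suc d) * rising j d * j !    ≡⟨ *-assoc (j + suc d) _ _ ⟩
    (j + suc d) * (rising j d * j !)  ≡⟨ cong ((j + suc d) *_) (rising-*-! j d) ⟩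
    (j + suc d) * (j + d) !           ≡⟨ cong (λ x → x * (j + d) !) (+-suc j d) ⟩
    suc (j + d) * (j + d) !           ≡⟨ cong _! (sym (+-suc j d)) ⟩
    (j + suc d) !                     ∎
    where open ≡-Reasoning

  suc^≤rising : ∀ j d → suc j ^ d ≤ rising j d
  suc^≤rising j zero = ≤-refl
  suc^≤rising j (suc d) = *-mono-≤ (≤-trans (s≤s (m≤m+n j d)) (≤-reflexive (sym (+-suc j d)))) (suc^≤rising j d)

  rising-pos : ∀ j d → 1 ≤ rising j d
  rising-pos j d = ≤-trans (m^n>0 (suc j) d) (suc^≤rising j d)

  rising≤^ : ∀ j d → rising j d ≤ (j + d) ^ d
  rising≤^ j zero = ≤-refl
  rising≤^ j (suc d) = *-monoʳ-≤ (j + suc d) (≤-trans (rising≤^ j d) (^-monoˡ-≤ d (+-monoʳ-≤ j (n≤1+n d))))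

  rising-shift-≤ : ∀ a e K → rising (a + e) K ≤ rising a (K + e)
  rising-shift-≤ a e zero = rising-pos a e
  rising-shift-≤ a e (suc K) = *-mono-≤ (≤-reflexive (lemma a e K)) (rising-shift-≤ a e K)
    where
    lemma : ∀ a e K → a + e + suc K ≡ a + suc (K + e)
    lemma a e K = trans (+-assoc a e (suc K)) (cong (a +_) (trans (+-suc e K) (cong suc (+-comm e K))))

  factorialRatio : ℕ → ℕ → ℕ
  factorialRatio m j = rising j (m ∸ j)

  factorialRatio-*-! : ∀ {m j} → j ≤ m → factorialRatio m j * j ! ≡ m !
  factorialRatio-*-! {m} {j} j≤m = trans (rising-*-! j (m ∸ j)) (cong _! (m+[n∸m]≡n j≤m))

  factorialRatio≤^ : ∀ {m j} → j ≤ m → factorialRatio m j ≤ m ^ (m ∸ j)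
  factorialRatio≤^ {m} {j} j≤m = ≤-trans (rising≤^ j (m ∸ j)) (≤-reflexive (cong (_^ (m ∸ j)) (m+[n∸m]≡n j≤m)))

  factorialRatio≤! : ∀ {m j} → j ≤ m → factorialRatio m j ≤ m !
  factorialRatio≤! {m} {j} j≤m = ≤-trans (m≤m*n (factorialRatio m j) (j !) {{j !≢0}}) (≤-reflexive (factorialRatio-*-! j≤m))

  C-*-!*! : ∀ a b → ((a + b) C a) * (a ! * b !) ≡ (a + b) !
  C-*-!*! a b = begin
    ((a + b) C a) * (a ! * b !)
      ≡⟨ cong₂ _*_ (nCk≡n!/k![n-k]! a≤a+b) (cong (λ x → a ! * x !) (sym (m+n∸m≡n a b))) ⟩
    ((a + b) ! / (a ! * (a + b ∸ a) !)) * (a ! * (a + b ∸ a) !) ≡⟨ m/n*n≡m (k![n∸k]!∣n! a≤a+b) ⟩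
    (a + b) !                                                   ∎
    where
    open ≡-Reasoning
    a≤a+b : a ≤ a + b
    a≤a+b = m≤m+n a b
    instance
      a!*b!≢0 : NonZero (a ! * (a + b ∸ a) !)
      a!*b!≢0 = a !* (a + b ∸ a) !≢0

  C-pos : ∀ a b → 1 ≤ (a + b) C a
  C-pos a b = n≢0⇒n>0 (λ C≡0 → contradiction (subst (1 ≤_) (trans (sym (C-*-!*! a b)) (cong (_* (a ! * b !)) C≡0)) (1≤n! (a + b))) λ ())

  C-≥2 : ∀ a t → 2 ≤ (suc a + suc t) C suc a
  C-≥2 a t = begin
    2                                       ≤⟨ +-mono-≤ (C-pos a (suc t)) (C-pos (suc a) t) ⟩
    (a + suc t) C a + (suc a + t) C suc a   ≡⟨ cong (λ n → (a + suc t) C a + n C suc a) (sym (+-suc a t)) ⟩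
    (a + suc t) C a + (a + suc t) C suc a   ≡⟨ nCk+nC[k+1]≡[n+1]C[k+1] (a + suc t) a ⟩
    (suc a + suc t) C suc a                 ∎
    where open ≤-Reasoning

  prodMap : ∀ {s} → (ℕ → ℕ) → Vec ℕ s → ℕ
  prodMap φ [] = 1
  prodMap φ (x ∷ xs) = φ x * prodMap φ xs

  prodMap-* : ∀ {s} (φ ψ : ℕ → ℕ) (c : Vec ℕ s) → prodMap (λ x → φ x * ψ x) c ≡ prodMap φ c * prodMap ψ c
  prodMap-* φ ψ [] = refl
  prodMap-* φ ψ (x ∷ c) rewrite prodMap-* φ ψ c = [m*n]*[o*p]≡[m*o]*[n*p] (φ x) (ψ x) _ _

  prodMap-const : ∀ {s} a (c : Vec ℕ s) → prodMap (λ _ → a) c ≡ a ^ s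
  prodMap-const a [] = refl
  prodMap-const a (x ∷ c) = cong (a *_) (prodMap-const a c)

  prodMap-cong : ∀ {s} {P : ℕ → Set} {φ ψ : ℕ → ℕ} {c : Vec ℕ s} →
                 (∀ {j} → P j → φ j ≡ ψ j) → All P c → prodMap φ c ≡ prodMap ψ c
  prodMap-cong φ≗ψ [] = refl
  prodMap-cong φ≗ψ (p ∷ ps) = cong₂ _*_ (φ≗ψ p) (prodMap-cong φ≗ψ ps)

  sum-≤-* : ∀ {s m} {c : Vec ℕ s} → All (_≤ m) c → Vec.sum c ≤ s * m
  sum-≤-* [] = z≤n
  sum-≤-* (x≤m ∷ c≤m) = +-mono-≤ x≤m (sum-≤-* c≤m)

  sum-replicate : ∀ s m → Vec.sum (Vec.replicate s m) ≡ s * m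
  sum-replicate zero m = refl
  sum-replicate (suc s) m = cong (m +_) (sum-replicate s m)

  prodMap-replicate : ∀ s φ m → prodMap φ (Vec.replicate s m) ≡ φ m ^ s
  prodMap-replicate zero φ m = refl
  prodMap-replicate (suc s) φ m = cong (φ m *_) (prodMap-replicate s φ m)

  ^-sum : ∀ {s} y (c : Vec ℕ s) → y ^ Vec.sum c ≡ prodMap (y ^_) c
  ^-sum y [] = refl
  ^-sum y (x ∷ c) = trans (^-distribˡ-+-* y x (Vec.sum c)) (cong (y ^ x *_) (^-sum y c))

  multinomial-*-∏! : ∀ {s} (c : Vec ℕ s) → multinomial c * prodMap _! c ≡ (Vec.sum c) !
  multinomial-*-∏! [] = refl
  multinomial-*-∏! (x ∷ c) = begin
    ((x + t) C x) * multinomial c * (x ! * prodMap _! c)   ≡⟨ regroup ((x + t) C x) (multinomial c) (x !) (prodMap _! c) ⟩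
    ((x + t) C x) * (x ! * (multinomial c * prodMap _! c)) ≡⟨ cong (λ z → ((x + t) C x) * (x ! * z)) (multinomial-*-∏! c) ⟩
    ((x + t) C x) * (x ! * t !)                            ≡⟨ C-*-!*! x t ⟩
    (x + t) !                                              ∎
    where
    open ≡-Reasoning
    t : ℕ
    t = Vec.sum c
    regroup : ∀ b M f p → b * M * (f * p) ≡ b * (f * (M * p))
    regroup = solve-∀

  multinomial-*-!^ : ∀ {s m} (c : Vec ℕ s) → All (_≤ m) c →
                     multinomial c * (m !) ^ s ≡ (Vec.sum c) ! * prodMap (factorialRatio m) c
  multinomial-*-!^ {s} {m} c c≤m = begin
    multinomial c * (m !) ^ s                                       ≡⟨ cong (multinomial c *_) (sym (prodMap-const (m !) c)) ⟩
    multinomial c * prodMap (λ _ → m !) c                           ≡⟨ cong (multinomial c *_) (prodMap-cong ratio-*-! c≤m) ⟩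
    multinomial c * prodMap (λ j → j ! * factorialRatio m j) c      ≡⟨ cong (multinomial c *_) (prodMap-* _! (factorialRatio m) c) ⟩
    multinomial c * (prodMap _! c * prodMap (factorialRatio m) c)   ≡⟨ sym (*-assoc (multinomial c) _ _) ⟩
    multinomial c * prodMap _! c * prodMap (factorialRatio m) c     ≡⟨ cong (_* prodMap (factorialRatio m) c) (multinomial-*-∏! c) ⟩
    (Vec.sum c) ! * prodMap (factorialRatio m) c                    ∎
    where
    open ≡-Reasoning
    ratio-*-! : ∀ {j} → j ≤ m → m ! ≡ j ! * factorialRatio m j
    ratio-*-! {j} j≤m = sym (trans (*-comm (j !) (factorialRatio m j)) (factorialRatio-*-! j≤m))

  multinomial-pos : ∀ {s} (c : Vec ℕ s) → 1 ≤ multinomial c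
  multinomial-pos [] = ≤-refl
  multinomial-pos (x ∷ c) = *-mono-≤ (C-pos x (Vec.sum c)) (multinomial-pos c)

  multinomial-replicate-≥ : ∀ r m → 1 ≤ m → r ≤ multinomial (Vec.replicate r m)
  multinomial-replicate-≥ zero m _ = z≤n
  multinomial-replicate-≥ (suc zero) m _ = multinomial-pos (Vec.replicate 1 m)
  multinomial-replicate-≥ (suc (suc r)) (suc a) _ = begin
    suc (suc r)                                         ≤⟨ s≤s (multinomial-replicate-≥ (suc r) (suc a) (s≤s z≤n)) ⟩
    suc (multinomial c)                                 ≤⟨ +-monoˡ-≤ (multinomial c) (multinomial-pos c) ⟩
    multinomial c + multinomial c                       ≡⟨ cong (multinomial c +_) (sym (+-identityʳ _)) ⟩
    2 * multinomial c                                   ≤⟨ *-monoˡ-≤ (multinomial c) (C-≥2 a (a + Vec.sum (Vec.replicate r (suc a)))) ⟩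
    ((suc a + Vec.sum c) C suc a) * multinomial c       ∎
    where
    open ≤-Reasoning
    c : Vec ℕ (suc r)
    c = Vec.replicate (suc r) (suc a)

  -- With y = n ∸ K: n!/a! ≥ y^(n−a) when n − a ≤ K, and n!/a! ≥ (y+1)⋯(y+K) otherwise.
  factorial-bound : ∀ {n K a} → a ≤ n →
                    a ! * ((n ∸ K) ^ n * rising (n ∸ K) K) ≤ n ! * ((n ∸ K) ^ a * rising (n ∸ K) K + (n ∸ K) ^ n)
  factorial-bound {n} {K} {a} a≤n = begin
    a ! * (y ^ n * F)   ≤⟨ *-monoʳ-≤ (a !) core ⟩
    a ! * (U * X)       ≡⟨ sym (*-assoc (a !) U X) ⟩
    a ! * U * X         ≡⟨ cong (_* X) (trans (*-comm (a !) U) (trans (rising-*-! a d) (cong _! a+d≡n))) ⟩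
    n ! * X             ∎
    where
    open ≤-Reasoning
    y F d U X : ℕ
    y = n ∸ K
    F = rising y K
    d = n ∸ a
    U = rising a d
    X = y ^ a * F + y ^ n
    a+d≡n : a + d ≡ n
    a+d≡n = m+[n∸m]≡n a≤n
    core : y ^ n * F ≤ U * X
    core with d ≤? K
    ... | yes d≤K = begin
      y ^ n * F          ≡⟨ cong (λ e → y ^ e * F) (trans (sym a+d≡n) (+-comm a d)) ⟩
      y ^ (d + a) * F    ≡⟨ cong (_* F) (^-distribˡ-+-* y d a) ⟩
      y ^ d * y ^ a * F  ≤⟨ *-monoˡ-≤ F (*-monoˡ-≤ (y ^ a) (≤-trans (^-monoˡ-≤ d y≤1+a) (suc^≤rising a d))) ⟩
      U * y ^ a * F      ≡⟨ *-assoc U (y ^ a) F ⟩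
      U * (y ^ a * F)    ≤⟨ *-monoʳ-≤ U (m≤m+n (y ^ a * F) (y ^ n)) ⟩
      U * X              ∎
      where
      y≤1+a : y ≤ suc a
      y≤1+a = ≤-trans (∸-monoʳ-≤ n d≤K) (≤-trans (≤-reflexive (trans (cong (_∸ d) (sym a+d≡n)) (m+n∸n≡m a d))) (n≤1+n a))
    ... | no d≰K = begin
      y ^ n * F          ≤⟨ *-monoʳ-≤ (y ^ n) F≤U ⟩
      y ^ n * U          ≡⟨ *-comm (y ^ n) U ⟩
      U * y ^ n          ≤⟨ *-monoʳ-≤ U (m≤n+m (y ^ n) (y ^ a * F)) ⟩
      U * X              ∎
      where
      K≤d : K ≤ d
      K≤d = ≤-trans (n≤1+n K) (≰⇒> d≰K)
      a+[d∸K]≡y : a + (d ∸ K) ≡ y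
      a+[d∸K]≡y = trans (sym (+-∸-assoc a K≤d)) (cong (_∸ K) a+d≡n)
      F≤U : F ≤ U
      F≤U = begin
        rising y K                    ≡⟨ cong (λ z → rising z K) (sym a+[d∸K]≡y) ⟩
        rising (a + (d ∸ K)) K        ≤⟨ rising-shift-≤ a (d ∸ K) K ⟩
        rising a (K + (d ∸ K))        ≡⟨ cong (rising a) (m+[n∸m]≡n K≤d) ⟩
        U                             ∎

module PowerBounds where

  open import Data.Nat using (ℕ; zero; suc; _+_; _*_; _∸_; _^_; _≤_; z≤n; _≤?_; NonZero; >-nonZero)
  open import Data.Nat.Properties
  open import Data.Fin using (toℕ)
  open import Relation.Nullary using (yes; no)
  open import Relation.Nullary.Decidable using (toWitness)
  open import Data.Product using (_,_)
  open import Relation.Binary.PropositionalEquality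
  open import Data.Nat.Tactic.RingSolver using (solve-∀)
  open import Algebra.Properties.Semiring.Sum +-*-semiring

  ^-distribʳ-* : ∀ x y q → (x * y) ^ q ≡ x ^ q * y ^ q
  ^-distribʳ-* x y zero = refl
  ^-distribʳ-* x y (suc q) rewrite ^-distribʳ-* x y q = [m*n]*[o*p]≡[m*o]*[n*p] x y (x ^ q) (y ^ q)

  geometric : ℕ → ℕ → ℕ → ℕ
  geometric x y d = ∑[ j < suc d ] (x ^ toℕ j * y ^ (d ∸ toℕ j))

  geometric-suc : ∀ x y d → geometric x y (suc d) ≡ y ^ suc d + x * geometric x y d
  geometric-suc x y d = cong₂ _+_ (*-identityˡ (y ^ suc d))
    (trans (sum-cong-≗ {suc d} (λ j → *-assoc x (x ^ toℕ j) (y ^ (d ∸ toℕ j))))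
           (sym (*-distribˡ-sum {suc d} x (λ j → x ^ toℕ j * y ^ (d ∸ toℕ j)))))

  geometric-telescope : ∀ m b d → b * geometric (m + b) m d + m ^ suc d ≡ (m + b) ^ suc d
  geometric-telescope m b zero = base m b
    where
    base : ∀ m b → b * 1 + m * 1 ≡ (m + b) * 1
    base = solve-∀
  geometric-telescope m b (suc d) = begin
    b * geometric (m + b) m (suc d) + m * m ^ suc d             ≡⟨ cong (λ g → b * g + m * m ^ suc d) (geometric-suc (m + b) m d) ⟩
    b * (m ^ suc d + (m + b) * G) + m * m ^ suc d               ≡⟨ regroup m b (m ^ suc d) G ⟩
    (m + b) * (b * G + m ^ suc d)                               ≡⟨ cong ((m + b) *_) (geometric-telescope m b d) ⟩
    (m + b) * (m + b) ^ suc d                                   ∎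
    where
    open ≡-Reasoning
    G : ℕ
    G = geometric (m + b) m d
    regroup : ∀ m b p G → b * (p + (m + b) * G) + m * p ≡ (m + b) * (b * G + p)
    regroup = solve-∀

  bernoulli-step : ∀ a b u → u ≤ b → (b + a) * (u ∸ a) ≤ b * u
  bernoulli-step a b u u≤b with a ≤? u
  ... | no a≰u = ≤-trans (≤-reflexive (trans (cong ((b + a) *_) (m≤n⇒m∸n≡0 (<⇒≤ (≰⇒> a≰u)))) (*-zeroʳ (b + a)))) z≤n
  ... | yes a≤u = begin
    (b + a) * (u ∸ a)            ≡⟨ *-distribʳ-+ (u ∸ a) b a ⟩
    b * (u ∸ a) + a * (u ∸ a)    ≤⟨ +-monoʳ-≤ (b * (u ∸ a)) (*-monoʳ-≤ a (≤-trans (m∸n≤m u a) u≤b)) ⟩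
    b * (u ∸ a) + a * b          ≡⟨ trans (cong (b * (u ∸ a) +_) (*-comm a b)) (sym (*-distribˡ-+ b (u ∸ a) a)) ⟩
    b * (u ∸ a + a)              ≡⟨ cong (b *_) (m∸n+n≡m a≤u) ⟩
    b * u                        ∎
    where open ≤-Reasoning

  bernoulli : ∀ a b s → (b + a) ^ s * (b ∸ s * a) ≤ b ^ suc s
  bernoulli a b zero = ≤-reflexive (trans (*-identityˡ b) (sym (*-identityʳ b)))
  bernoulli a b (suc s) = begin
    (b + a) * (b + a) ^ s * (b ∸ (a + s * a))  ≡⟨ cong (λ z → (b + a) * (b + a) ^ s * (b ∸ z)) (+-comm a (s * a)) ⟩
    (b + a) * (b + a) ^ s * (b ∸ (s * a + a))  ≡⟨ cong ((b + a) * (b + a) ^ s *_) (sym (∸-+-assoc b (s * a) a)) ⟩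
    (b + a) * (b + a) ^ s * (u ∸ a)            ≡⟨ x*y*z≡y*[x*z] (b + a) ((b + a) ^ s) (u ∸ a) ⟩
    (b + a) ^ s * ((b + a) * (u ∸ a))          ≤⟨ *-monoʳ-≤ ((b + a) ^ s) (bernoulli-step a b u (m∸n≤m b (s * a))) ⟩
    (b + a) ^ s * (b * u)                      ≡⟨ x*[y*z]≡y*[x*z] ((b + a) ^ s) b u ⟩
    b * ((b + a) ^ s * u)                      ≤⟨ *-monoʳ-≤ b (bernoulli a b s) ⟩
    b * b ^ suc s                              ∎
    where
    open ≤-Reasoning
    u : ℕ
    u = b ∸ s * a
    x*y*z≡y*[x*z] : ∀ x y z → x * y * z ≡ y * (x * z)
    x*y*z≡y*[x*z] = solve-∀
    x*[y*z]≡y*[x*z] : ∀ x y z → x * (y * z) ≡ y * (x * z)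
    x*[y*z]≡y*[x*z] = solve-∀

  power-ratio-mono : ∀ a b {r R} → r ≤ R → (b + a) ^ r * b ^ R ≤ (b + a) ^ R * b ^ r
  power-ratio-mono a b {r} r≤R with m≤n⇒∃[o]m+o≡n r≤R
  ... | t , refl = begin
    (b + a) ^ r * b ^ (r + t)              ≡⟨ cong ((b + a) ^ r *_) (^-distribˡ-+-* b r t) ⟩
    (b + a) ^ r * (b ^ r * b ^ t)          ≤⟨ *-monoʳ-≤ ((b + a) ^ r) (*-monoʳ-≤ (b ^ r) (^-monoˡ-≤ t (m≤m+n b a))) ⟩
    (b + a) ^ r * (b ^ r * (b + a) ^ t)    ≡⟨ x*[y*z]≡x*z*y ((b + a) ^ r) (b ^ r) ((b + a) ^ t) ⟩
    (b + a) ^ r * (b + a) ^ t * b ^ r      ≡⟨ cong (_* b ^ r) (sym (^-distribˡ-+-* (b + a) r t)) ⟩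
    (b + a) ^ (r + t) * b ^ r              ∎
    where
    open ≤-Reasoning
    x*[y*z]≡x*z*y : ∀ x y z → x * (y * z) ≡ x * z * y
    x*[y*z]≡x*z*y = solve-∀

  100*100000^100≤280*98990^100 : 100 * 100000 ^ 100 ≤ 280 * 98990 ^ 100
  100*100000^100≤280*98990^100 = toWitness {a? = 100 * 100000 ^ 100 ≤? 280 * 98990 ^ 100} _

  ^100-bound : ∀ b u → 98990 * b ≤ 100000 * u → 100 * b ^ 100 ≤ 280 * u ^ 100
  ^100-bound b u 98990b≤100000u = *-cancelʳ-≤ (100 * b ^ 100) (280 * u ^ 100) (100000 ^ 100) {{m^n≢0 100000 100}} (begin
    100 * b ^ 100 * 100000 ^ 100       ≡⟨ regroup₁ (b ^ 100) (100000 ^ 100) ⟩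
    b ^ 100 * (100 * 100000 ^ 100)     ≤⟨ *-monoʳ-≤ (b ^ 100) 100*100000^100≤280*98990^100 ⟩
    b ^ 100 * (280 * 98990 ^ 100)      ≡⟨ regroup₂ (b ^ 100) (98990 ^ 100) ⟩
    280 * (98990 ^ 100 * b ^ 100)      ≡⟨ cong (280 *_) (sym (^-distribʳ-* 98990 b 100)) ⟩
    280 * (98990 * b) ^ 100            ≤⟨ *-monoʳ-≤ 280 (^-monoˡ-≤ 100 98990b≤100000u) ⟩
    280 * (100000 * u) ^ 100           ≡⟨ cong (280 *_) (^-distribʳ-* 100000 u 100) ⟩
    280 * (100000 ^ 100 * u ^ 100)     ≡⟨ regroup₃ (100000 ^ 100) (u ^ 100) ⟩
    280 * u ^ 100 * 100000 ^ 100       ∎)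
    where
    open ≤-Reasoning
    regroup₁ : ∀ B C → 100 * B * C ≡ B * (100 * C)
    regroup₁ = solve-∀
    regroup₂ : ∀ B D → B * (280 * D) ≡ 280 * (D * B)
    regroup₂ = solve-∀
    regroup₃ : ∀ C U → 280 * (C * U) ≡ 280 * U * C
    regroup₃ = solve-∀

  bernoulli-remainder-bound : ∀ a b s → 100000 * (s * a) ≤ 1010 * b → 98990 * b ≤ 100000 * (b ∸ s * a)
  bernoulli-remainder-bound a b s small = begin
    98990 * b                                ≡⟨ sym (m+n∸n≡m (98990 * b) (1010 * b)) ⟩
    98990 * b + 1010 * b ∸ 1010 * b          ≡⟨ cong (_∸ 1010 * b) (sym (*-distribʳ-+ b 98990 1010)) ⟩
    100000 * b ∸ 1010 * b                    ≤⟨ ∸-monoʳ-≤ (100000 * b) small ⟩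
    100000 * b ∸ 100000 * (s * a)            ≡⟨ sym (*-distribˡ-∸ 100000 b (s * a)) ⟩
    100000 * (b ∸ s * a)                     ∎
    where open ≤-Reasoning

  -- (1 + a/b)^s ≤ b/(b − s a) by Bernoulli, and (100000/98990)^100 < 2.8.
  e-bound-multiple : ∀ a b s → 100000 * (s * a) ≤ 1010 * b → 1 ≤ b →
                     100 * (b + a) ^ (100 * s) ≤ 280 * b ^ (100 * s)
  e-bound-multiple a b s small 1≤b = *-cancelʳ-≤ _ _ (b ^ 100) {{m^n≢0 b 100 {{>-nonZero 1≤b}}}} (begin
    100 * (b + a) ^ (100 * s) * b ^ 100
      ≡⟨ cong (λ z → 100 * z * b ^ 100) (trans (cong ((b + a) ^_) (*-comm 100 s)) (sym (^-*-assoc (b + a) s 100))) ⟩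
    100 * X ^ 100 * b ^ 100                ≡⟨ regroup₁ (X ^ 100) (b ^ 100) ⟩
    X ^ 100 * (100 * b ^ 100)              ≤⟨ *-monoʳ-≤ (X ^ 100) (^100-bound b u (bernoulli-remainder-bound a b s small)) ⟩
    X ^ 100 * (280 * u ^ 100)              ≡⟨ regroup₂ (X ^ 100) (u ^ 100) ⟩
    280 * (X ^ 100 * u ^ 100)              ≡⟨ cong (280 *_) (sym (^-distribʳ-* X u 100)) ⟩
    280 * (X * u) ^ 100                    ≤⟨ *-monoʳ-≤ 280 (^-monoˡ-≤ 100 (bernoulli a b s)) ⟩
    280 * (b ^ suc s) ^ 100                ≡⟨ cong (280 *_) (trans (^-*-assoc b (suc s) 100) (cong (b ^_) (exponent s))) ⟩
    280 * b ^ (100 * s + 100)              ≡⟨ cong (280 *_) (^-distribˡ-+-* b (100 * s) 100) ⟩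
    280 * (b ^ (100 * s) * b ^ 100)        ≡⟨ sym (*-assoc 280 (b ^ (100 * s)) (b ^ 100)) ⟩
    280 * b ^ (100 * s) * b ^ 100          ∎)
    where
    open ≤-Reasoning
    X u : ℕ
    X = (b + a) ^ s
    u = b ∸ s * a
    regroup₁ : ∀ Y B → 100 * Y * B ≡ Y * (100 * B)
    regroup₁ = solve-∀
    regroup₂ : ∀ Y U → Y * (280 * U) ≡ 280 * (Y * U)
    regroup₂ = solve-∀
    exponent : ∀ s → suc s * 100 ≡ 100 * s + 100
    exponent = solve-∀

  e-bound : ∀ a b r s → r ≤ 100 * s → 100000 * (s * a) ≤ 1010 * b → 1 ≤ b → 100 * (b + a) ^ r ≤ 280 * b ^ r
  e-bound a b r s r≤100s small 1≤b = *-cancelʳ-≤ _ _ (b ^ R) {{m^n≢0 b R {{>-nonZero 1≤b}}}} (begin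
    100 * (b + a) ^ r * b ^ R      ≡⟨ *-assoc 100 ((b + a) ^ r) (b ^ R) ⟩
    100 * ((b + a) ^ r * b ^ R)    ≤⟨ *-monoʳ-≤ 100 (power-ratio-mono a b r≤100s) ⟩
    100 * ((b + a) ^ R * b ^ r)    ≡⟨ sym (*-assoc 100 ((b + a) ^ R) (b ^ r)) ⟩
    100 * (b + a) ^ R * b ^ r      ≤⟨ *-monoˡ-≤ (b ^ r) (e-bound-multiple a b s small 1≤b) ⟩
    280 * b ^ R * b ^ r            ≡⟨ regroup (b ^ R) (b ^ r) ⟩
    280 * b ^ r * b ^ R            ∎)
    where
    open ≤-Reasoning
    R : ℕ
    R = 100 * s
    regroup : ∀ B C → 280 * B * C ≡ 280 * C * B
    regroup = solve-∀

  100*A^r≤r^K : ∀ A r K → 1 ≤ A → 1 ≤ K → r ≤ K * 1000 + 1000 → 100 * A ^ 2000 ≤ r → 100 * A ^ r ≤ r ^ K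
  100*A^r≤r^K A r K 1≤A 1≤K r≤ 100A²⁰⁰⁰≤r = begin
    100 * A ^ r                   ≤⟨ *-monoʳ-≤ 100 (^-monoʳ-≤ A (≤-trans r≤ exponent≤)) ⟩
    100 * A ^ (2000 * K)          ≡⟨ cong (100 *_) (sym (^-*-assoc A 2000 K)) ⟩
    100 * (A ^ 2000) ^ K          ≤⟨ *-monoˡ-≤ ((A ^ 2000) ^ K) 100≤100^K ⟩
    100 ^ K * (A ^ 2000) ^ K      ≡⟨ sym (^-distribʳ-* 100 (A ^ 2000) K) ⟩
    (100 * A ^ 2000) ^ K          ≤⟨ ^-monoˡ-≤ K 100A²⁰⁰⁰≤r ⟩
    r ^ K                         ∎
    where
    open ≤-Reasoning
    instance
      A≢0 : NonZero A
      A≢0 = >-nonZero 1≤A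
    exponent≤ : K * 1000 + 1000 ≤ 2000 * K
    exponent≤ = ≤-trans (+-monoʳ-≤ (K * 1000) (*-monoʳ-≤ 1000 1≤K)) (≤-reflexive (regroup K))
      where
      regroup : ∀ K → K * 1000 + 1000 * K ≡ 2000 * K
      regroup = solve-∀
    100≤100^K : 100 ≤ 100 ^ K
    100≤100^K = ≤-trans (≤-reflexive (sym (*-identityʳ 100))) (^-monoʳ-≤ 100 1≤K)

module MainEstimate where

  open import Data.Nat using (ℕ; zero; suc; _+_; _*_; _∸_; _^_; _≤_; z≤n; s≤s; _!; _/_; _%_; NonZero; >-nonZero)
  open import Data.Nat.Properties
  open import Data.Nat.DivMod using (m/n*n≤m; m≡m%n+[m/n]*n; m%n<n; m≥n⇒m/n>0)
  open import Data.Fin using (Fin; toℕ)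
  open import Data.Fin.Properties using (toℕ≤pred[n])
  open import Data.Vec as Vec using (Vec; []; _∷_)
  open import Data.Vec.Relation.Unary.All using (All; []; _∷_)
  open import Function using (_∘_)
  open import Relation.Binary.PropositionalEquality
  open import Data.Nat.Tactic.RingSolver using (solve-∀)
  open import Algebra.Properties.Semiring.Sum +-*-semiring using (sum-syntax; sum-cong-≗; *-distribˡ-sum)
  open FinSum using (∑-mono-≤; ∑-≤-*)
  open Multinomial using (boxSum; boxSum-+; multinomial; multinomialBox)
  open Factorials
  open PowerBounds

  boxSum-scale : ∀ {s} (b : Vec ℕ s) a f → boxSum b (λ c → a * f c) ≡ a * boxSum b f
  boxSum-scale [] a f = refl
  boxSum-scale (x ∷ b) a f = trans (sum-cong-≗ {suc x} (λ j → boxSum-scale b a (f ∘ (toℕ j ∷_))))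
                                   (sym (*-distribˡ-sum {suc x} a (λ j → boxSum b (f ∘ (toℕ j ∷_)))))

  boxSum-mono : ∀ {s} m {f g : Vec ℕ s → ℕ} → (∀ c → All (_≤ m) c → f c ≤ g c) →
                boxSum (Vec.replicate s m) f ≤ boxSum (Vec.replicate s m) g
  boxSum-mono {zero} m f≤g = f≤g [] []
  boxSum-mono {suc s} m f≤g = ∑-mono-≤ (λ j → boxSum-mono {s} m (λ c c≤m → f≤g (toℕ j ∷ c) (toℕ≤pred[n] j ∷ c≤m)))

  boxSum-prodMap : ∀ {s} m φ → boxSum (Vec.replicate s m) (prodMap φ) ≡ (∑[ j < suc m ] φ (toℕ j)) ^ s
  boxSum-prodMap {zero} m φ = refl
  boxSum-prodMap {suc s} m φ = begin
    ∑[ j < suc m ] boxSum c (λ cs → φ (toℕ j) * prodMap φ cs)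
      ≡⟨ sum-cong-≗ {suc m} (λ j → trans (boxSum-scale c (φ (toℕ j)) (prodMap φ)) (*-comm (φ (toℕ j)) _)) ⟩
    ∑[ j < suc m ] (boxSum c (prodMap φ) * φ (toℕ j))           ≡⟨ sym (*-distribˡ-sum {suc m} (boxSum c (prodMap φ)) (φ ∘ toℕ)) ⟩
    boxSum c (prodMap φ) * ∑[ j < suc m ] φ (toℕ j)             ≡⟨ cong (_* Σφ) (boxSum-prodMap {s} m φ) ⟩
    Σφ ^ s * Σφ                                                  ≡⟨ *-comm (Σφ ^ s) Σφ ⟩
    Σφ ^ suc s                                                   ∎
    where
    open ≡-Reasoning
    c : Vec ℕ s
    c = Vec.replicate s m
    Σφ : ℕ
    Σφ = ∑[ j < suc m ] φ (toℕ j)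

  -- The constants fit because 6 (2.8 + 1/100) + 6/43 < 17.
  combine-estimates : ∀ Φ D Y F N P p r →
    Φ * (D * (Y * F)) ≤ N * F * P + N * Y * p →
    100 * P ≤ 280 * Y → 100 * p ≤ F → r * D ≤ N → 43 ≤ r → 1 ≤ Y * F →
    6 * suc Φ * D ≤ 17 * N
  combine-estimates Φ D Y F N P p r Φ-bound P-bound p-bound D-bound 43≤r 1≤YF =
    *-cancelʳ-≤ (6 * suc Φ * D) (17 * N) (100 * r * (Y * F)) {{nonZero}} (begin
      6 * suc Φ * D * (100 * r * (Y * F))                               ≡⟨ expand Φ D r (Y * F) ⟩
      600 * r * (Φ * (D * (Y * F))) + 600 * (r * D) * (Y * F)
        ≤⟨ +-mono-≤ (*-monoʳ-≤ (600 * r) Φ-bound) (*-monoˡ-≤ (Y * F) (*-monoʳ-≤ 600 D-bound)) ⟩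
      600 * r * (N * F * P + N * Y * p) + 600 * N * (Y * F)               ≡⟨ regroup r N F P Y p ⟩
      6 * r * N * F * (100 * P) + 6 * r * N * Y * (100 * p) + 600 * N * (Y * F)
        ≤⟨ +-monoˡ-≤ (600 * N * (Y * F)) (+-mono-≤ (*-monoʳ-≤ (6 * r * N * F) P-bound) (*-monoʳ-≤ (6 * r * N * Y) p-bound)) ⟩
      6 * r * N * F * (280 * Y) + 6 * r * N * Y * F + 600 * N * (Y * F)    ≡⟨ collect r N F Y ⟩
      N * (Y * F) * (1686 * r + 600)
        ≤⟨ *-monoʳ-≤ (N * (Y * F)) (+-monoʳ-≤ (1686 * r) (≤-trans (m≤m+n 600 2) (*-monoʳ-≤ 14 43≤r))) ⟩
      N * (Y * F) * (1686 * r + 14 * r)                                   ≡⟨ finish N (Y * F) r ⟩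
      17 * N * (100 * r * (Y * F))                                        ∎)
    where
    open ≤-Reasoning
    nonZero : NonZero (100 * r * (Y * F))
    nonZero = >-nonZero (*-mono-≤ (*-mono-≤ (s≤s (z≤n {99})) (≤-trans (s≤s z≤n) 43≤r)) 1≤YF)
    expand : ∀ Φ D r Q → 6 * suc Φ * D * (100 * r * Q) ≡ 600 * r * (Φ * (D * Q)) + 600 * (r * D) * Q
    expand = solve-∀
    regroup : ∀ r N F P Y p → 600 * r * (N * F * P + N * Y * p) + 600 * N * (Y * F) ≡
                              6 * r * N * F * (100 * P) + 6 * r * N * Y * (100 * p) + 600 * N * (Y * F)
    regroup = solve-∀
    collect : ∀ r N F Y → 6 * r * N * F * (280 * Y) + 6 * r * N * Y * F + 600 * N * (Y * F) ≡ N * (Y * F) * (1686 * r + 600)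
    collect = solve-∀
    finish : ∀ N Q r → N * Q * (1686 * r + 14 * r) ≡ 17 * N * (100 * r * Q)
    finish = solve-∀

  threshold : ℕ → ℕ
  threshold m = 100 * (suc m * m !) ^ 2000 + 50000

  module _ (m r : ℕ) (2≤m : 2 ≤ m) (threshold≤r : threshold m ≤ r) where

    n K y F A s b P p : ℕ
    n = r * m
    K = r / 1000
    y = n ∸ K
    F = rising y K
    A = suc m * m !
    s = suc (r / 100)
    b = y ∸ m
    P = ∑[ j < suc m ] (factorialRatio m (toℕ j) * y ^ toℕ j)
    p = ∑[ j < suc m ] factorialRatio m (toℕ j)

    50000≤r : 50000 ≤ r
    50000≤r = ≤-trans (m≤n+m 50000 _) threshold≤r

    100A²⁰⁰⁰≤r : 100 * A ^ 2000 ≤ r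
    100A²⁰⁰⁰≤r = ≤-trans (m≤m+n _ 50000) threshold≤r

    1≤A : 1 ≤ A
    1≤A = *-mono-≤ (s≤s (z≤n {m})) (1≤n! m)

    2m≤r : 2 * m ≤ r
    2m≤r = begin
      2 * m            ≤⟨ *-mono-≤ (m≤m+n 2 98) (≤-trans (n≤1+n m) (m≤m*n (suc m) (m !) {{m !≢0}})) ⟩
      100 * A          ≤⟨ *-monoʳ-≤ 100 (≤-trans (≤-reflexive (sym (*-identityʳ A))) (*-monoʳ-≤ A (m^n>0 A {{>-nonZero 1≤A}} 1999))) ⟩
      100 * A ^ 2000   ≤⟨ 100A²⁰⁰⁰≤r ⟩
      r                ∎
      where open ≤-Reasoning

    1000K≤r : K * 1000 ≤ r
    1000K≤r = m/n*n≤m r 1000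

    r≤1000K+1000 : r ≤ K * 1000 + 1000
    r≤1000K+1000 = begin
      r                       ≡⟨ m≡m%n+[m/n]*n r 1000 ⟩
      r % 1000 + K * 1000     ≤⟨ +-monoˡ-≤ (K * 1000) (<⇒≤ (m%n<n r 1000)) ⟩
      1000 + K * 1000         ≡⟨ +-comm 1000 (K * 1000) ⟩
      K * 1000 + 1000         ∎
      where open ≤-Reasoning

    1≤K : 1 ≤ K
    1≤K = m≥n⇒m/n>0 {r} {1000} (≤-trans (m≤m+n 1000 49000) 50000≤r)

    K≤r : K ≤ r
    K≤r = ≤-trans (m≤m*n K 1000) 1000K≤r

    2r≤n : 2 * r ≤ n
    2r≤n = ≤-trans (≤-reflexive (*-comm 2 r)) (*-monoʳ-≤ r 2≤m)

    y+K≡n : y + K ≡ n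
    y+K≡n = m∸n+n≡m (≤-trans K≤r (≤-trans (m≤m+n r (r + 0)) 2r≤n))

    r≤y : r ≤ y
    r≤y = begin
      r              ≡⟨ sym (m+n∸n≡m r r) ⟩
      r + r ∸ r      ≤⟨ ∸-monoˡ-≤ r (≤-trans (≤-reflexive (cong (r +_) (sym (+-identityʳ r)))) 2r≤n) ⟩
      n ∸ r          ≤⟨ ∸-monoʳ-≤ n K≤r ⟩
      y              ∎
      where open ≤-Reasoning

    m+b≡y : m + b ≡ y
    m+b≡y = m+[n∸m]≡n (≤-trans (m≤n*m m 2) (≤-trans 2m≤r r≤y))

    r≤100s : r ≤ 100 * s
    r≤100s = begin
      r                        ≡⟨ m≡m%n+[m/n]*n r 100 ⟩
      r % 100 + r / 100 * 100  ≤⟨ +-monoˡ-≤ (r / 100 * 100) (<⇒≤ (m%n<n r 100)) ⟩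
      100 + r / 100 * 100      ≡⟨ regroup (r / 100) ⟩
      100 * s                  ∎
      where
      open ≤-Reasoning
      regroup : ∀ q → 100 + q * 100 ≡ 100 * suc q
      regroup = solve-∀

    100s≤r+100 : 100 * s ≤ r + 100
    100s≤r+100 = begin
      100 * s                  ≡⟨ *-suc 100 (r / 100) ⟩
      100 + 100 * (r / 100)    ≤⟨ +-monoʳ-≤ 100 (≤-trans (≤-reflexive (*-comm 100 (r / 100))) (m/n*n≤m r 100)) ⟩
      100 + r                  ≡⟨ +-comm 100 r ⟩
      r + 100                  ∎
      where open ≤-Reasoning

    101010m+1010K≤10n : 101010 * m + 1010 * K ≤ 10 * n
    101010m+1010K≤10n = begin
      101010 * m + 1010 * K      ≤⟨ +-mono-≤ (*-monoˡ-≤ m 101010≤9r) 1010K≤2r ⟩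
      9 * r * m + 2 * r          ≤⟨ +-monoʳ-≤ (9 * r * m) 2r≤n ⟩
      9 * r * m + r * m          ≡⟨ regroup r m ⟩
      10 * n                     ∎
      where
      open ≤-Reasoning
      101010≤9r : 101010 ≤ 9 * r
      101010≤9r = ≤-trans (m≤m+n 101010 348990) (*-monoʳ-≤ 9 50000≤r)
      1010K≤2r : 1010 * K ≤ 2 * r
      1010K≤2r = ≤-trans (*-monoˡ-≤ K (m≤m+n 1010 990))
                   (≤-trans (≤-reflexive (*-assoc 2 1000 K)) (*-monoʳ-≤ 2 (≤-trans (≤-reflexive (*-comm 1000 K)) 1000K≤r)))
      regroup : ∀ r m → 9 * r * m + r * m ≡ 10 * (r * m)
      regroup = solve-∀

    bernoulli-condition : 100000 * (s * m) ≤ 1010 * b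
    bernoulli-condition = +-cancelʳ-≤ (1010 * m + 1010 * K) _ _ (begin
      100000 * (s * m) + (1010 * m + 1010 * K)          ≡⟨ cong (_+ (1010 * m + 1010 * K)) (regroup₁ s m) ⟩
      1000 * m * (100 * s) + (1010 * m + 1010 * K)      ≤⟨ +-monoˡ-≤ (1010 * m + 1010 * K) (*-monoʳ-≤ (1000 * m) 100s≤r+100) ⟩
      1000 * m * (r + 100) + (1010 * m + 1010 * K)      ≡⟨ regroup₂ m r K ⟩
      1000 * n + (101010 * m + 1010 * K)                ≤⟨ +-monoʳ-≤ (1000 * n) 101010m+1010K≤10n ⟩
      1000 * n + 10 * n                                 ≡⟨ sym (*-distribʳ-+ n 1000 10) ⟩
      1010 * n                                          ≡⟨ cong (1010 *_) (sym b+m+K≡n) ⟩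
      1010 * (b + m + K)                                ≡⟨ regroup₃ b m K ⟩
      1010 * b + (1010 * m + 1010 * K)                  ∎)
      where
      open ≤-Reasoning
      b+m+K≡n : b + m + K ≡ n
      b+m+K≡n = trans (cong (_+ K) (trans (+-comm b m) m+b≡y)) y+K≡n
      regroup₁ : ∀ s m → 100000 * (s * m) ≡ 1000 * m * (100 * s)
      regroup₁ = solve-∀
      regroup₂ : ∀ m r K → 1000 * m * (r + 100) + (1010 * m + 1010 * K) ≡ 1000 * (r * m) + (101010 * m + 1010 * K)
      regroup₂ = solve-∀
      regroup₃ : ∀ b m K → 1010 * (b + m + K) ≡ 1010 * b + (1010 * m + 1010 * K)
      regroup₃ = solve-∀

    1≤b : 1 ≤ b
    1≤b = begin
      1            ≤⟨ ≤-trans (s≤s z≤n) 2≤m ⟩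
      m            ≡⟨ sym (trans (cong (λ x → m + x ∸ m) (+-identityʳ m)) (m+n∸m≡n m m)) ⟩
      2 * m ∸ m    ≤⟨ ∸-monoˡ-≤ m (≤-trans 2m≤r r≤y) ⟩
      b            ∎
      where open ≤-Reasoning

    1≤y^nF : 1 ≤ y ^ n * F
    1≤y^nF = *-mono-≤ (m^n>0 y {{>-nonZero (≤-trans (≤-trans (s≤s z≤n) 50000≤r) r≤y)}} n) (rising-pos y K)

    pointwise-bound : ∀ (c : Vec ℕ r) → All (_≤ m) c →
                      (m !) ^ r * (y ^ n * F) * multinomial c ≤
                      n ! * F * prodMap (λ j → factorialRatio m j * y ^ j) c + n ! * y ^ n * prodMap (factorialRatio m) c
    pointwise-bound c c≤m = begin
      (m !) ^ r * Q * multinomial c                         ≡⟨ regroup₁ ((m !) ^ r) Q (multinomial c) ⟩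
      Q * (multinomial c * (m !) ^ r)                       ≡⟨ cong (Q *_) (multinomial-*-!^ c c≤m) ⟩
      Q * ((Vec.sum c) ! * G)                               ≡⟨ regroup₂ Q ((Vec.sum c) !) G ⟩
      G * ((Vec.sum c) ! * Q)                               ≤⟨ *-monoʳ-≤ G (factorial-bound {n} {K} (sum-≤-* c≤m)) ⟩
      G * (n ! * (y ^ Vec.sum c * F + y ^ n))               ≡⟨ regroup₃ G (n !) (y ^ Vec.sum c) F (y ^ n) ⟩
      n ! * F * (G * y ^ Vec.sum c) + n ! * y ^ n * G       ≡⟨ cong (λ z → n ! * F * z + n ! * y ^ n * G) G*y^sum ⟩
      n ! * F * prodMap (λ j → factorialRatio m j * y ^ j) c + n ! * y ^ n * G ∎
      where
      open ≤-Reasoning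
      Q G : ℕ
      Q = y ^ n * F
      G = prodMap (factorialRatio m) c
      G*y^sum : G * y ^ Vec.sum c ≡ prodMap (λ j → factorialRatio m j * y ^ j) c
      G*y^sum = trans (cong (G *_) (^-sum y c)) (sym (prodMap-* (factorialRatio m) (y ^_) c))
      regroup₁ : ∀ D Q M → D * Q * M ≡ Q * (M * D)
      regroup₁ = solve-∀
      regroup₂ : ∀ Q f G → Q * (f * G) ≡ G * (f * Q)
      regroup₂ = solve-∀
      regroup₃ : ∀ G N a F Y → G * (N * (a * F + Y)) ≡ N * F * (G * a) + N * Y * G
      regroup₃ = solve-∀

    multinomialBox-bound : multinomialBox (Vec.replicate r m) * ((m !) ^ r * (y ^ n * F)) ≤ n ! * F * P ^ r + n ! * y ^ n * p ^ r
    multinomialBox-bound = begin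
      boxSum c multinomial * W                           ≡⟨ *-comm (boxSum c multinomial) W ⟩
      W * boxSum c multinomial                           ≡⟨ sym (boxSum-scale c W multinomial) ⟩
      boxSum c (λ c′ → W * multinomial c′)               ≤⟨ boxSum-mono m pointwise-bound ⟩
      boxSum c (λ c′ → n ! * F * Π₁ c′ + n ! * y ^ n * Π₂ c′)
        ≡⟨ boxSum-+ c (λ c′ → n ! * F * Π₁ c′) (λ c′ → n ! * y ^ n * Π₂ c′) ⟩
      boxSum c (λ c′ → n ! * F * Π₁ c′) + boxSum c (λ c′ → n ! * y ^ n * Π₂ c′)
        ≡⟨ cong₂ _+_ (boxSum-scale c (n ! * F) Π₁) (boxSum-scale c (n ! * y ^ n) Π₂) ⟩
      n ! * F * boxSum c Π₁ + n ! * y ^ n * boxSum c Π₂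
        ≡⟨ cong₂ (λ u v → n ! * F * u + n ! * y ^ n * v)
                 (boxSum-prodMap {r} m (λ j → factorialRatio m j * y ^ j)) (boxSum-prodMap {r} m (factorialRatio m)) ⟩
      n ! * F * P ^ r + n ! * y ^ n * p ^ r              ∎
      where
      open ≤-Reasoning
      c : Vec ℕ r
      c = Vec.replicate r m
      W : ℕ
      W = (m !) ^ r * (y ^ n * F)
      Π₁ Π₂ : Vec ℕ r → ℕ
      Π₁ = prodMap (λ j → factorialRatio m j * y ^ j)
      Π₂ = prodMap (factorialRatio m)

    b*P≤y^[1+m] : b * P ≤ y ^ suc m
    b*P≤y^[1+m] = begin
      b * P                                   ≤⟨ *-monoʳ-≤ b (∑-mono-≤ termwise) ⟩
      b * geometric y m m                     ≡⟨ cong (λ x → b * geometric x m m) (sym m+b≡y) ⟩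
      b * geometric (m + b) m m               ≤⟨ m≤m+n _ (m ^ suc m) ⟩
      b * geometric (m + b) m m + m ^ suc m   ≡⟨ geometric-telescope m b m ⟩
      (m + b) ^ suc m                         ≡⟨ cong (_^ suc m) m+b≡y ⟩
      y ^ suc m                               ∎
      where
      open ≤-Reasoning
      termwise : ∀ (j : Fin (suc m)) → factorialRatio m (toℕ j) * y ^ toℕ j ≤ y ^ toℕ j * m ^ (m ∸ toℕ j)
      termwise j = ≤-trans (*-monoˡ-≤ (y ^ toℕ j) (factorialRatio≤^ (toℕ≤pred[n] j))) (≤-reflexive (*-comm _ (y ^ toℕ j)))

    P-bound : 100 * P ^ r ≤ 280 * y ^ n
    P-bound = *-cancelʳ-≤ (100 * P ^ r) (280 * y ^ n) (b ^ r) {{m^n≢0 b r {{>-nonZero 1≤b}}}} (begin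
      100 * P ^ r * b ^ r              ≡⟨ trans (*-assoc 100 (P ^ r) (b ^ r)) (cong (100 *_) (trans (*-comm (P ^ r) (b ^ r)) (sym (^-distribʳ-* b P r)))) ⟩
      100 * (b * P) ^ r                ≤⟨ *-monoʳ-≤ 100 (^-monoˡ-≤ r b*P≤y^[1+m]) ⟩
      100 * (y ^ suc m) ^ r            ≡⟨ cong (100 *_) (trans (^-*-assoc y (suc m) r) (trans (cong (y ^_) (exponent m r)) (^-distribˡ-+-* y n r))) ⟩
      100 * (y ^ n * y ^ r)            ≡⟨ x*[y*z]≡y*[x*z] 100 (y ^ n) (y ^ r) ⟩
      y ^ n * (100 * y ^ r)            ≤⟨ *-monoʳ-≤ (y ^ n) (subst (λ x → 100 * x ^ r ≤ 280 * b ^ r) (trans (+-comm b m) m+b≡y)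
                                            (e-bound m b r s r≤100s bernoulli-condition 1≤b)) ⟩
      y ^ n * (280 * b ^ r)            ≡⟨ sym (trans (*-assoc 280 (y ^ n) (b ^ r)) (x*[y*z]≡y*[x*z] 280 (y ^ n) (b ^ r))) ⟩
      280 * y ^ n * b ^ r              ∎)
      where
      open ≤-Reasoning
      exponent : ∀ m r → suc m * r ≡ r * m + r
      exponent = solve-∀
      x*[y*z]≡y*[x*z] : ∀ x y z → x * (y * z) ≡ y * (x * z)
      x*[y*z]≡y*[x*z] = solve-∀

    p-bound : 100 * p ^ r ≤ F
    p-bound = begin
      100 * p ^ r       ≤⟨ *-monoʳ-≤ 100 (^-monoˡ-≤ r (∑-≤-* {suc m} (λ j → factorialRatio≤! (toℕ≤pred[n] j)))) ⟩
      100 * A ^ r       ≤⟨ 100*A^r≤r^K A r K 1≤A 1≤K r≤1000K+1000 100A²⁰⁰⁰≤r ⟩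
      r ^ K             ≤⟨ ^-monoˡ-≤ K (≤-trans r≤y (n≤1+n y)) ⟩
      suc y ^ K         ≤⟨ suc^≤rising y K ⟩
      F                 ∎
      where open ≤-Reasoning

    r*m!^r≤n! : r * (m !) ^ r ≤ n !
    r*m!^r≤n! = begin
      r * (m !) ^ r                            ≤⟨ *-monoˡ-≤ ((m !) ^ r) (multinomial-replicate-≥ r m (≤-trans (s≤s z≤n) 2≤m)) ⟩
      multinomial c * (m !) ^ r                ≡⟨ cong (multinomial c *_) (sym (prodMap-replicate r _! m)) ⟩
      multinomial c * prodMap _! c             ≡⟨ multinomial-*-∏! c ⟩
      (Vec.sum c) !                            ≡⟨ cong _! (sum-replicate r m) ⟩
      n !                                      ∎
      where
      open ≤-Reasoning
      c : Vec ℕ r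
      c = Vec.replicate r m

    main-inequality : 6 * suc (multinomialBox (Vec.replicate r m)) * (m !) ^ r ≤ 17 * n !
    main-inequality = combine-estimates (multinomialBox (Vec.replicate r m)) ((m !) ^ r) (y ^ n) F (n !) (P ^ r) (p ^ r) r
                        multinomialBox-bound P-bound p-bound r*m!^r≤n!
                        (≤-trans (m≤m+n 43 49957) 50000≤r) 1≤y^nF

open import Data.Nat as ℕ using (ℕ)
open import Data.Integer using (+_)
open import Data.Rational using (ℚ; _/_; 0ℚ; 1ℚ; _+_; _*_; _≤_; _<_)
open import Data.Product using (∃-syntax; _×_)

open import Data.Product using (_,_)
import Data.Nat.Properties as ℕ
import Data.Integer as ℤ
import Data.Integer.Properties as ℤ
open import Data.Rational using (nonNegative)
open import Data.Rational.Properties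
import Data.Rational.Unnormalised as ℚᵘ
import Data.Rational.Unnormalised.Properties as ℚᵘ
open import Data.Vec using (replicate)
open import Relation.Binary.PropositionalEquality using (_≡_; sym; subst)
open import Data.Nat.Tactic.RingSolver using (solve-∀)
open RamseyRecursion using (ramsey-recursive)
open Multinomial using (multinomialBox; multinomialBox-recursive)
open MainEstimate using (threshold; main-inequality)

-- Cross-multiplication is only available for unnormalised rationals.
ℕ-bound⇒ℚ-bound : ∀ N F D {{_ : ℕ.NonZero D}} → 6 ℕ.* N ℕ.* D ℕ.≤ 17 ℕ.* F → + N / 1 ≤ (+ 17 / 6) * (+ F / D)
ℕ-bound⇒ℚ-bound N F (ℕ.suc D′) 6ND≤17F =
  toℚᵘ-cancel-≤ (ℚᵘ.≤-respˡ-≃ (ℚᵘ.≃-sym (toℚᵘ-fromℚᵘ (ℚᵘ.mkℚᵘ (+ N) 0)))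
    (ℚᵘ.≤-respʳ-≃ (ℚᵘ.≃-sym (ℚᵘ.≃-trans (toℚᵘ-homo-* (+ 17 / 6) (+ F / ℕ.suc D′))
                                        (ℚᵘ.*-cong (toℚᵘ-fromℚᵘ (ℚᵘ.mkℚᵘ (+ 17) 5)) (toℚᵘ-fromℚᵘ (ℚᵘ.mkℚᵘ (+ F) D′)))))
       (ℚᵘ.*≤* cross-multiplied)))
  where
  cross-multiplied : + N ℤ.* + (6 ℕ.* ℕ.suc D′) ℤ.≤ (+ 17 ℤ.* + F) ℤ.* + 1
  cross-multiplied rewrite sym (ℤ.pos-* N (6 ℕ.* ℕ.suc D′)) | sym (ℤ.pos-* 17 F) | sym (ℤ.pos-* (17 ℕ.* F) 1) =
    ℤ.+≤+ (ℕ.≤-trans (ℕ.≤-reflexive (regroup N (ℕ.suc D′))) (ℕ.≤-trans 6ND≤17F (ℕ.≤-reflexive (sym (ℕ.*-identityʳ (17 ℕ.* F))))))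
    where
    regroup : ∀ N d → N ℕ.* (6 ℕ.* d) ≡ 6 ℕ.* N ℕ.* d
    regroup = solve-∀

p≤p+q : ∀ p q → 0ℚ ≤ q → p ≤ p + q
p≤p+q p q 0≤q = ≤-trans (≤-reflexive (sym (+-identityʳ p))) (+-monoʳ-≤ p 0≤q)

p≤p*[1+ε]+δ : ∀ p ε δ → 0ℚ ≤ p → 0ℚ ≤ ε → 0ℚ ≤ δ → p ≤ p * (1ℚ + ε) + δ
p≤p*[1+ε]+δ p ε δ 0≤p 0≤ε 0≤δ = ≤-trans p≤p*[1+ε] (p≤p+q _ δ 0≤δ)
  where
  p≤p*[1+ε] : p ≤ p * (1ℚ + ε)
  p≤p*[1+ε] = ≤-trans (≤-reflexive (sym (*-identityʳ p))) (*-monoˡ-≤-nonNeg p {{nonNegative 0≤p}} (p≤p+q 1ℚ ε 0≤ε))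

corollary3p9 : (k : ℕ) → 4 ℕ.≤ k →
    (ε : ℚ) → 0ℚ < ε →
    ∃[ r₀ ] ((r : ℕ) → 2 ℕ.≤ r → r₀ ℕ.≤ r →
      ∃[ N ] (RamseyProperty r k N ×
        ((δ : ℚ) → 0ℚ < δ →
          ∃[ n ] (+ N / 1 ≤ ((+ 3 / 1 + expPartial n) * (+ 1 / 2)) * multinomBound r k * (1ℚ + ε) + δ))))
corollary3p9 k 4≤k ε 0<ε = threshold m , λ r _ threshold≤r →
  ℕ.suc (multinomialBox (replicate r m)) , ramsey r , λ δ 0<δ → 3 , bound r threshold≤r δ 0<δ
  where
  m : ℕ
  m = k ℕ.∸ 2
  2≤k : 2 ℕ.≤ k
  2≤k = ℕ.≤-trans (ℕ.m≤m+n 2 2) 4≤k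
  ramsey : ∀ r → RamseyProperty r k (ℕ.suc (multinomialBox (replicate r m)))
  ramsey r = subst (λ k′ → RamseyProperty r k′ (ℕ.suc (multinomialBox (replicate r m)))) (ℕ.m+[n∸m]≡n 2≤k)
                   (ramsey-recursive multinomialBox multinomialBox-recursive m)
  bound : ∀ r → threshold m ℕ.≤ r → ∀ δ → 0ℚ < δ →
          + ℕ.suc (multinomialBox (replicate r m)) / 1 ≤ ((+ 3 / 1 + expPartial 3) * (+ 1 / 2)) * multinomBound r k * (1ℚ + ε) + δ
  bound r threshold≤r δ 0<δ =
    ≤-trans N≤bound (p≤p*[1+ε]+δ _ ε δ (≤-trans (nonNegative⁻¹ (+ N / 1) {{normalize-nonNeg N 1}}) N≤bound) (<⇒≤ 0<ε) (<⇒≤ 0<δ))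
    where
    N : ℕ
    N = ℕ.suc (multinomialBox (replicate r m))
    -- (+ 3 / 1 + expPartial 3) * (+ 1 / 2) computes to + 17 / 6.
    N≤bound : + N / 1 ≤ ((+ 3 / 1 + expPartial 3) * (+ 1 / 2)) * multinomBound r k
    N≤bound = ℕ-bound⇒ℚ-bound N ((r ℕ.* m) ℕ.!) ((m ℕ.!) ℕ.^ r) {{ℕ.m^n≢0 (m ℕ.!) r {{m ℕ.!≢0}}}}
                (main-inequality m r (ℕ.∸-monoˡ-≤ 2 4≤k) threshold≤r)
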